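{- Let $N=2n$, consider the double chain on $N$ points, and let $k\ge 1$. Let $F_I(N,k)$ be the set of non-crossing forests with exactly $k$ edges, each edge joining a point of the upper chain to a point of the lower chain. Then $$|F_I(N,k)|=\sum_{\ell=1}^{\min(k,n)}\sum_{i=1}^{n-\ell+1}\sum_{j=1}^{n-\ell+1}\binom{n-i}{\ell-1}\binom{n-j}{\ell-1}\binom{2n-\ell-i-j+1}{k-\ell}.$$
   Context: The double chain on $2n$ points (no three collinear) consists of two sets of $n$ points each, an upper chain forming a convex chain and a lower chain forming a concave chain, such that every straight line through two points of the upper chain leaves all points of the lower chain on the same side, and vice versa. Edges are straight-line segments; a set of edges is non-crossing if no two of them intersect except at common endpoints. Elements of $F_I(N,k)$ are counted as edge sets. -}

module Defs where

open import Data.Nat using (ℕ; zero; suc; _+_; _∸_; _≤_; _⊓_)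
open import Data.Nat.Combinatorics using (_C_)
open import Data.Bool using (Bool; true; false)
open import Data.Fin using (Fin; zero; suc; inject₁; fromℕ; _<_)
open import Data.Vec using (Vec; lookup)
import Data.Vec as V
open import Data.List using (List; map; applyUpTo)
open import Data.Nat.ListAction using (sum)
open import Data.Sum using (_⊎_; inj₁; inj₂)
open import Data.Product using (Σ; _×_)
open import Data.Empty using (⊥)
open import Relation.Binary.PropositionalEquality using (_≡_)
open import Relation.Nullary using (¬_)
open import Function.Definitions using (Injective)

-- Upper chain points u_0,…,u_{n-1} and
-- lower chain points l_0,…,l_{n-1}, both indexed from left to right.
-- An "inter-chain" edge u_a l_b is represented by the pair (a , b).
-- An edge set of inter-chain edges is an n×n Boolean matrix:
-- row a, column b is true iff the edge u_a l_b is present.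
EdgeSet : ℕ → Set
EdgeSet n = Vec (Vec Bool n) n

HasEdge : ∀ {n} → EdgeSet n → Fin n → Fin n → Set
HasEdge E a b = lookup (lookup E a) b ≡ true

countTrue : ∀ {m} → Vec Bool m → ℕ
countTrue V.[] = 0
countTrue (true V.∷ xs) = suc (countTrue xs)
countTrue (false V.∷ xs) = countTrue xs

numEdges : ∀ {n} → EdgeSet n → ℕ
numEdges E = V.sum (V.map countTrue E)

-- Geometric crossing in the double chain: two inter-chain segments
-- u_a l_b and u_a' l_b' cross (at an interior point) iff a < a' and b' < b
-- (or symmetrically); segments sharing an endpoint never cross.
NonCrossing : ∀ {n} → EdgeSet n → Set
NonCrossing {n} E = ∀ (a b a' b' : Fin n) → HasEdge E a b → HasEdge E a' b' →
                    a < a' → b' < b → ⊥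

-- The geometric graph on all 2n points: upper vertices inj₁ a, lower inj₂ b.
Vertex : ℕ → Set
Vertex n = Fin n ⊎ Fin n

Adj : ∀ {n} → EdgeSet n → Vertex n → Vertex n → Set
Adj E (inj₁ a) (inj₁ a') = ⊥
Adj E (inj₁ a) (inj₂ b) = HasEdge E a b
Adj E (inj₂ b) (inj₁ a) = HasEdge E a b
Adj E (inj₂ b) (inj₂ b') = ⊥

record Cycle {n} (E : EdgeSet n) : Set where
  field
    m      : ℕ
    long   : 2 ≤ m
    c      : Fin (suc m) → Vertex n
    inj    : Injective _≡_ _≡_ c
    step   : ∀ (i : Fin m) → Adj E (c (inject₁ i)) (c (suc i))
    close  : Adj E (c (fromℕ m)) (c zero)

IsForest : ∀ {n} → EdgeSet n → Set
IsForest E = ¬ Cycle E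

InFI : (n k : ℕ) → EdgeSet n → Set
InFI n k E = NonCrossing E × IsForest E × numEdges E ≡ k

∑[1…_] : ℕ → (ℕ → ℕ) → ℕ
∑[1… m ] f = sum (map f (applyUpTo suc m))

-- right-hand side of the formula (all truncated subtractions are
-- exact within the summation ranges)
formula : ℕ → ℕ → ℕ
formula n k =
  ∑[1… k ⊓ n ] λ ℓ →
  ∑[1… (n + 1) ∸ ℓ ] λ i →
  ∑[1… (n + 1) ∸ ℓ ] λ j →
    ((n ∸ i) C (ℓ ∸ 1)) Data.Nat.* ((n ∸ j) C (ℓ ∸ 1)) Data.Nat.*
    (((2 Data.Nat.* n + 1) ∸ (ℓ + i + j)) C (k ∸ ℓ))

{-# OPTIONS --safe #-}
module Submission where

-- A non-crossing set of inter-chain edges is automatically a forest: on a cycle, the rightmost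
-- upper vertex a has two lower neighbours b < b', and b' has a second upper neighbour a' < a,
-- so the edges a b and a' b' cross.  So F_I(2n,k) consists of the non-crossing n × n edge
-- matrices with k edges.  Reading a matrix row by row (upper point by upper point) and
-- remembering only the rightmost lower point used so far, the edge generating function t p w
-- of non-crossing sets between p upper and w lower points satisfies
--   t(p+1,w+1) + (1+x) t(p,w) = (1+x) (t(p+1,w) + t(p,w+1)).
-- By Pascal's rule, (1+x) g(p,w) with g(u,v) = Σ_m C(u,m) C(v,m) x^m (1+x)^(u+v-m) satisfies
-- the same recurrence; cancelling 1+x turns it into the additive recurrence of
-- 1 + x Σ_{u<p,v<w} g(u,v).  So t(n,n) = 1 + x Σ_{u,v<n} g(u,v), and the coefficient of x^k
-- is the formula under the substitution u = n - i, v = n - j, m = ℓ - 1.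

open import Defs
open import Data.Nat using (ℕ; _≤_)
open import Data.List using (List; length)
open import Data.List.Membership.Propositional using (_∈_)
open import Data.List.Relation.Unary.Unique.Propositional using (Unique)
open import Data.Product using (Σ; _×_)
open import Relation.Binary.PropositionalEquality using (_≡_)

module FiniteSums where

  open import Data.Nat
  open import Data.Nat.Properties
  open import Algebra.Properties.CommutativeSemigroup +-commutativeSemigroup using (interchange)
  open import Data.List using (map; applyUpTo)
  open import Data.Nat.ListAction using (sum)
  open import Relation.Binary.PropositionalEquality

  ∑< : ℕ → (ℕ → ℕ) → ℕ
  ∑< zero    f = 0
  ∑< (suc B) f = f 0 + ∑< B (λ i → f (suc i))

  ∑<-cong : ∀ B {f g : ℕ → ℕ} → (∀ i → i < B → f i ≡ g i) → ∑< B f ≡ ∑< B g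
  ∑<-cong zero    f≡g = refl
  ∑<-cong (suc B) f≡g = cong₂ _+_ (f≡g 0 z<s) (∑<-cong B (λ i i<B → f≡g (suc i) (s<s i<B)))

  ∑<-zero : ∀ B {f : ℕ → ℕ} → (∀ i → i < B → f i ≡ 0) → ∑< B f ≡ 0
  ∑<-zero zero    f≡0 = refl
  ∑<-zero (suc B) f≡0 = cong₂ _+_ (f≡0 0 z<s) (∑<-zero B (λ i i<B → f≡0 (suc i) (s<s i<B)))

  ∑<-+ : ∀ B (f g : ℕ → ℕ) → ∑< B (λ i → f i + g i) ≡ ∑< B f + ∑< B g
  ∑<-+ zero    f g = refl
  ∑<-+ (suc B) f g = trans (cong (f 0 + g 0 +_) (∑<-+ B _ _)) (interchange (f 0) (g 0) _ _)

  ∑<-suc : ∀ B (f : ℕ → ℕ) → ∑< (suc B) f ≡ ∑< B f + f B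
  ∑<-suc zero    f = +-comm (f 0) 0
  ∑<-suc (suc B) f = trans (cong (f 0 +_) (∑<-suc B _)) (sym (+-assoc (f 0) _ _))

  ∑<-extend : ∀ {a b} (f : ℕ → ℕ) → a ≤ b → (∀ i → a ≤ i → i < b → f i ≡ 0) → ∑< b f ≡ ∑< a f
  ∑<-extend f a≤b = go (≤⇒≤′ a≤b)
    where
    go : ∀ {a b} → a ≤′ b → (∀ i → a ≤ i → i < b → f i ≡ 0) → ∑< b f ≡ ∑< a f
    go ≤′-refl             _    = refl
    go {a} {suc b} (≤′-step a≤′b) f≡0 = begin
      ∑< (suc b) f  ≡⟨ ∑<-suc b f ⟩
      ∑< b f + f b  ≡⟨ cong₂ _+_ (go a≤′b λ i a≤i i<b → f≡0 i a≤i (m≤n⇒m≤1+n i<b)) (f≡0 b (≤′⇒≤ a≤′b) (n<1+n b)) ⟩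
      ∑< a f + 0    ≡⟨ +-identityʳ _ ⟩
      ∑< a f        ∎
      where open ≡-Reasoning

  ∑<-comm : ∀ A B (f : ℕ → ℕ → ℕ) → ∑< A (λ i → ∑< B (f i)) ≡ ∑< B (λ j → ∑< A (λ i → f i j))
  ∑<-comm zero    B f = sym (∑<-zero B (λ _ _ → refl))
  ∑<-comm (suc A) B f = trans (cong (∑< B (f 0) +_) (∑<-comm A B (λ i → f (suc i)))) (sym (∑<-+ B (f 0) _))

  ∑<-reverse : ∀ B (f : ℕ → ℕ) → ∑< B (λ i → f (B ∸ suc i)) ≡ ∑< B f
  ∑<-reverse zero    f = refl
  ∑<-reverse (suc B) f = trans (cong (f B +_) (∑<-reverse B f)) (trans (+-comm (f B) _) (sym (∑<-suc B f)))

  sum-applyUpTo : ∀ m (f h : ℕ → ℕ) → sum (map f (applyUpTo h m)) ≡ ∑< m (λ i → f (h i))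
  sum-applyUpTo zero    f h = refl
  sum-applyUpTo (suc m) f h = cong (f (h 0) +_) (sum-applyUpTo m f (λ i → h (suc i)))

  ∑[1…]≡∑< : ∀ m f → ∑[1… m ] f ≡ ∑< m (λ i → f (suc i))
  ∑[1…]≡∑< m f = sum-applyUpTo m f suc


module PowerSeries where

  open import Data.Nat
  open import Data.Nat.Properties
  open import Data.Nat.Combinatorics using (_C_; nCk+nC[k+1]≡[n+1]C[k+1]; k>n⇒nCk≡0)
  open import Algebra.Properties.CommutativeSemigroup +-commutativeSemigroup using (interchange)
  open import Relation.Binary.PropositionalEquality
  open import Relation.Binary.Bundles using (Setoid)
  import Relation.Binary.Reasoning.Setoid as SetoidReasoning
  open FiniteSums

  Series : Set
  Series = ℕ → ℕ

  module ≗-Reasoning = SetoidReasoning (ℕ →-setoid ℕ)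
  open Setoid (ℕ →-setoid ℕ) public using () renaming (refl to ≗-refl; sym to ≗-sym; trans to ≗-trans)

  infixl 6 _⊕_
  infixl 7 _•_

  one : Series
  one zero    = 1
  one (suc k) = 0

  _⊕_ : Series → Series → Series
  (f ⊕ g) k = f k + g k

  _•_ : ℕ → Series → Series
  (a • f) k = a * f k

  X : Series → Series
  X f zero    = 0
  X f (suc k) = f k

  1+X : Series → Series
  1+X f = f ⊕ X f

  X^ : ℕ → Series → Series
  X^ zero    f = f
  X^ (suc m) f = X (X^ m f)

  [1+X]^ : ℕ → Series
  [1+X]^ N k = N C k

  ∑ˢ : ℕ → (ℕ → Series) → Series
  ∑ˢ B h k = ∑< B (λ m → h m k)

  X-cong : ∀ {f g} → f ≗ g → X f ≗ X g
  X-cong f≗g zero    = refl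
  X-cong f≗g (suc k) = f≗g k

  1+X-cong : ∀ {f g} → f ≗ g → 1+X f ≗ 1+X g
  1+X-cong f≗g k = cong₂ _+_ (f≗g k) (X-cong f≗g k)

  X^-cong : ∀ m {f g} → f ≗ g → X^ m f ≗ X^ m g
  X^-cong zero    f≗g = f≗g
  X^-cong (suc m) f≗g = X-cong (X^-cong m f≗g)

  ⊕-cong : ∀ {f g f' g'} → f ≗ f' → g ≗ g' → f ⊕ g ≗ f' ⊕ g'
  ⊕-cong f≗f' g≗g' k = cong₂ _+_ (f≗f' k) (g≗g' k)

  ⊕-congˡ : ∀ f {g h} → g ≗ h → f ⊕ g ≗ f ⊕ h
  ⊕-congˡ f g≗h k = cong (f k +_) (g≗h k)

  ⊕-congʳ : ∀ f {g h} → g ≗ h → g ⊕ f ≗ h ⊕ f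
  ⊕-congʳ f g≗h k = cong (_+ f k) (g≗h k)

  ⊕-comm : ∀ f g → f ⊕ g ≗ g ⊕ f
  ⊕-comm f g k = +-comm (f k) (g k)

  •-cong-≢0 : ∀ a {f g} → (a ≢ 0 → f ≗ g) → a • f ≗ a • g
  •-cong-≢0 zero    f≗g k = refl
  •-cong-≢0 (suc a) f≗g k = cong (suc a *_) (f≗g (λ ()) k)

  X-⊕ : ∀ f g → X (f ⊕ g) ≗ X f ⊕ X g
  X-⊕ f g zero    = refl
  X-⊕ f g (suc k) = refl

  X-• : ∀ a f → X (a • f) ≗ a • X f
  X-• a f zero    = sym (*-zeroʳ a)
  X-• a f (suc k) = refl

  X-∑ˢ : ∀ B h → X (∑ˢ B h) ≗ ∑ˢ B (λ m → X (h m))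
  X-∑ˢ B h zero    = sym (∑<-zero B (λ _ _ → refl))
  X-∑ˢ B h (suc k) = refl

  1+X-⊕ : ∀ f g → 1+X (f ⊕ g) ≗ 1+X f ⊕ 1+X g
  1+X-⊕ f g k = trans (cong (f k + g k +_) (X-⊕ f g k)) (interchange (f k) (g k) _ _)

  1+X-• : ∀ a f → 1+X (a • f) ≗ a • 1+X f
  1+X-• a f k = trans (cong (a * f k +_) (X-• a f k)) (sym (*-distribˡ-+ a (f k) _))

  1+X-∑ˢ : ∀ B h → 1+X (∑ˢ B h) ≗ ∑ˢ B (λ m → 1+X (h m))
  1+X-∑ˢ B h k = trans (cong (∑ˢ B h k +_) (X-∑ˢ B h k)) (sym (∑<-+ B (λ m → h m k) (λ m → X (h m) k)))

  X^-1+X : ∀ m f → X^ m (1+X f) ≗ 1+X (X^ m f)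
  X^-1+X zero    f = ≗-refl
  X^-1+X (suc m) f = ≗-trans (X-cong (X^-1+X m f)) (X-⊕ (X^ m f) (X (X^ m f)))

  ⊕-cancelʳ : ∀ h {f g} → f ⊕ h ≗ g ⊕ h → f ≗ g
  ⊕-cancelʳ h eq k = +-cancelʳ-≡ (h k) _ _ (eq k)

  1+X-injective : ∀ {f g} → 1+X f ≗ 1+X g → f ≗ g
  1+X-injective {f} {g} eq zero    = trans (sym (+-identityʳ (f 0))) (trans (eq 0) (+-identityʳ (g 0)))
  1+X-injective {f} {g} eq (suc k) =
    +-cancelʳ-≡ (f k) (f (suc k)) (g (suc k)) (trans (eq (suc k)) (cong (g (suc k) +_) (sym (1+X-injective eq k))))

  [1+X]^-zero : [1+X]^ 0 ≗ one
  [1+X]^-zero zero    = refl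
  [1+X]^-zero (suc k) = k>n⇒nCk≡0 {0} {suc k} z<s

  [1+X]^-suc : ∀ N → [1+X]^ (suc N) ≗ 1+X ([1+X]^ N)
  [1+X]^-suc N zero    = refl
  [1+X]^-suc N (suc k) = trans (sym (nCk+nC[k+1]≡[n+1]C[k+1] N k)) (+-comm (N C k) _)

  X^-≤ : ∀ m f k → m ≤ k → X^ m f k ≡ f (k ∸ m)
  X^-≤ zero    f k       _         = refl
  X^-≤ (suc m) f (suc k) (s≤s m≤k) = X^-≤ m f k m≤k

  X^-> : ∀ m f k → k < m → X^ m f k ≡ 0
  X^-> (suc m) f zero    _         = refl
  X^-> (suc m) f (suc k) (s≤s k<m) = X^-> m f k k<m


module BasisSums where

  open import Data.Nat
  open import Data.Nat.Properties
  open import Data.Nat.Combinatorics using (_C_; nCk+nC[k+1]≡[n+1]C[k+1]; k>n⇒nCk≡0)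
  open import Relation.Binary.PropositionalEquality
  open import Relation.Nullary using (contradiction; yes; no)
  open FiniteSums
  open PowerSeries

  shift : (ℕ → ℕ) → ℕ → ℕ
  shift α zero    = 0
  shift α (suc m) = α m

  C-suc : ∀ u m → suc u C m ≡ u C m + shift (u C_) m
  C-suc u zero    = refl
  C-suc u (suc m) = trans (sym (nCk+nC[k+1]≡[n+1]C[k+1] u m)) (+-comm (u C m) _)

  C*≢0⇒≤ : ∀ u m x → (u C m) * x ≢ 0 → m ≤ u
  C*≢0⇒≤ u m x ≢0 with m ≤? u
  ... | yes m≤u = m≤u
  ... | no  m≰u = contradiction (cong (_* x) (k>n⇒nCk≡0 (≰⇒> m≰u))) ≢0

  *C≢0⇒≤ : ∀ x v m → x * (v C m) ≢ 0 → m ≤ v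
  *C≢0⇒≤ x v m ≢0 with m ≤? v
  ... | yes m≤v = m≤v
  ... | no  m≰v = contradiction (trans (cong (x *_) (k>n⇒nCk≡0 (≰⇒> m≰v))) (*-zeroʳ x)) ≢0

  basisSum : ℕ → ℕ → (ℕ → ℕ) → Series
  basisSum B N α = ∑ˢ B (λ m → α m • X^ m ([1+X]^ (N ∸ m)))

  basisSum-cong : ∀ B N {α β} → (∀ m → m < B → α m ≡ β m) → basisSum B N α ≗ basisSum B N β
  basisSum-cong B N α≡β k = ∑<-cong B (λ m m<B → cong (_* _) (α≡β m m<B))

  basisSum-+ : ∀ B N α β → basisSum B N (λ m → α m + β m) ≗ basisSum B N α ⊕ basisSum B N β
  basisSum-+ B N α β k = trans (∑<-cong B (λ m _ → *-distribʳ-+ _ (α m) (β m))) (∑<-+ B _ _)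

  basisSum-extend : ∀ {B B'} N α → B ≤ B' → (∀ m → B ≤ m → m < B' → α m ≡ 0) →
                    basisSum B' N α ≗ basisSum B N α
  basisSum-extend N α B≤B' α≡0 k = ∑<-extend _ B≤B' (λ m B≤m m<B' → cong (_* _) (α≡0 m B≤m m<B'))

  basisSum-shift : ∀ B N α → basisSum (suc B) (suc N) (shift α) ≗ X (basisSum B N α)
  basisSum-shift B N α k = sym (trans (X-∑ˢ B _ k) (∑<-cong B (λ m _ → X-• (α m) _ k)))

  basisSum-suc : ∀ B N α → (∀ m → m < B → α m ≢ 0 → m ≤ N) → basisSum B (suc N) α ≗ 1+X (basisSum B N α)
  basisSum-suc B N α bound k = trans (∑<-cong B (λ m m<B → term m m<B k)) (sym (1+X-∑ˢ B _ k))
    where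
    term : ∀ m → m < B → α m • X^ m ([1+X]^ (suc N ∸ m)) ≗ 1+X (α m • X^ m ([1+X]^ (N ∸ m)))
    term m m<B = begin
      α m • X^ m ([1+X]^ (suc N ∸ m))
        ≈⟨ •-cong-≢0 (α m) (λ α≢0 → X^-cong m (λ k → cong (_C k) (+-∸-assoc 1 (bound m m<B α≢0)))) ⟩
      α m • X^ m ([1+X]^ (suc (N ∸ m)))
        ≈⟨ •-cong-≢0 (α m) (λ _ → ≗-trans (X^-cong m ([1+X]^-suc (N ∸ m))) (X^-1+X m _)) ⟩
      α m • 1+X (X^ m ([1+X]^ (N ∸ m)))
        ≈⟨ ≗-sym (1+X-• (α m) _) ⟩
      1+X (α m • X^ m ([1+X]^ (N ∸ m)))  ∎
      where open ≗-Reasoning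


module GeneratingFunctions where

  open import Data.Nat
  open import Data.Nat.Properties
  open import Data.Nat.Combinatorics using (_C_; k>n⇒nCk≡0)
  open import Data.Nat.Tactic.RingSolver using (solve-∀)
  open import Algebra.Properties.CommutativeSemigroup +-commutativeSemigroup using (xy∙z≈xz∙y)
  open import Relation.Binary.PropositionalEquality
  open FiniteSums
  open PowerSeries
  open BasisSums

  g : ℕ → ℕ → Series
  g u v = basisSum (suc u) (u + v) (λ m → (u C m) * (v C m))

  -- Pascal's rule C(u+1,m) = C(u,m) + C(u,m-1) splits the coefficients of g; the parts with
  -- one shifted factor are P and Q, and the part with both factors shifted is x(1+x) g u v.
  module Recurrence (u v : ℕ) where
    a b : ℕ → ℕ
    a m = u C m
    b m = v C m

    B : ℕ
    B = suc (suc u)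

    G P Q : Series
    G = basisSum B (u + v) (λ m → a m * b m)
    P = basisSum B (suc (u + v)) (λ m → shift a m * b m)
    Q = basisSum B (suc (u + v)) (λ m → a m * shift b m)

    ab≢0⇒≤ : ∀ m → a m * b m ≢ 0 → m ≤ u + v
    ab≢0⇒≤ m ≢0 = m≤n⇒m≤n+o v (C*≢0⇒≤ u m (b m) ≢0)

    g≗G : g u v ≗ G
    g≗G = ≗-sym (basisSum-extend (u + v) _ (n≤1+n (suc u)) (λ m u<m _ → cong (_* b m) (k>n⇒nCk≡0 u<m)))

    G-suc : basisSum B (suc (u + v)) (λ m → a m * b m) ≗ 1+X G
    G-suc = basisSum-suc B (u + v) _ (λ m _ → ab≢0⇒≤ m)

    g-sucˡ : g (suc u) v ≗ 1+X G ⊕ P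
    g-sucˡ = begin
      g (suc u) v
        ≈⟨ basisSum-cong B _ (λ m _ → trans (cong (_* b m) (C-suc u m)) (*-distribʳ-+ (b m) (a m) _)) ⟩
      basisSum B (suc (u + v)) (λ m → a m * b m + shift a m * b m)
        ≈⟨ ≗-trans (basisSum-+ B _ (λ m → a m * b m) (λ m → shift a m * b m)) (⊕-congʳ P G-suc) ⟩
      1+X G ⊕ P ∎
      where open ≗-Reasoning

    g-sucʳ : g u (suc v) ≗ 1+X G ⊕ Q
    g-sucʳ = begin
      g u (suc v)
        ≡⟨ cong (λ N → basisSum (suc u) N (λ m → a m * (suc v C m))) (+-suc u v) ⟩
      basisSum (suc u) (suc (u + v)) (λ m → a m * (suc v C m))
        ≈⟨ ≗-sym (basisSum-extend _ _ (n≤1+n (suc u)) (λ m u<m _ → cong (_* (suc v C m)) (k>n⇒nCk≡0 u<m))) ⟩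
      basisSum B (suc (u + v)) (λ m → a m * (suc v C m))
        ≈⟨ basisSum-cong B _ (λ m _ → trans (cong (a m *_) (C-suc v m)) (*-distribˡ-+ (a m) (b m) _)) ⟩
      basisSum B (suc (u + v)) (λ m → a m * b m + a m * shift b m)
        ≈⟨ ≗-trans (basisSum-+ B _ (λ m → a m * b m) (λ m → a m * shift b m)) (⊕-congʳ Q G-suc) ⟩
      1+X G ⊕ Q ∎
      where open ≗-Reasoning

    g-suc-suc : g (suc u) (suc v) ≗ 1+X (1+X G) ⊕ 1+X P ⊕ 1+X Q ⊕ X (1+X G)
    g-suc-suc = begin
      g (suc u) (suc v)
        ≡⟨ cong (λ N → basisSum B N (λ m → (suc u C m) * (suc v C m))) (cong suc (+-suc u v)) ⟩
      basisSum B N₂ (λ m → (suc u C m) * (suc v C m))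
        ≈⟨ basisSum-cong B N₂ (λ m _ → expand m) ⟩
      basisSum B N₂ (λ m → ab m + a'b m + ab' m + shift ab m)
        ≈⟨ ≗-trans (basisSum-+ B N₂ (λ m → ab m + a'b m + ab' m) (shift ab))
                   (⊕-congʳ _ (≗-trans (basisSum-+ B N₂ (λ m → ab m + a'b m) ab')
                                       (⊕-congʳ _ (basisSum-+ B N₂ ab a'b)))) ⟩
      basisSum B N₂ ab ⊕ basisSum B N₂ a'b ⊕ basisSum B N₂ ab' ⊕ basisSum B N₂ (shift ab)
        ≈⟨ ⊕-cong (⊕-cong (⊕-cong
             (≗-trans (basisSum-suc B N₁ ab (λ m _ ≢0 → m≤n⇒m≤1+n (ab≢0⇒≤ m ≢0))) (1+X-cong G-suc))
             (basisSum-suc B N₁ a'b (λ m _ ≢0 → m≤n⇒m≤1+n (m≤n⇒m≤o+n u (*C≢0⇒≤ (shift a m) v m ≢0)))))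
             (basisSum-suc B N₁ ab' (λ m _ ≢0 → m≤n⇒m≤1+n (m≤n⇒m≤n+o v (C*≢0⇒≤ u m (shift b m) ≢0)))))
             (≗-trans (basisSum-shift (suc u) N₁ ab)
                      (X-cong (≗-trans (basisSum-suc (suc u) (u + v) ab (λ m _ → ab≢0⇒≤ m)) (1+X-cong g≗G)))) ⟩
      1+X (1+X G) ⊕ 1+X P ⊕ 1+X Q ⊕ X (1+X G) ∎
      where
      open ≗-Reasoning
      N₁ N₂ : ℕ
      N₁ = suc (u + v)
      N₂ = suc N₁
      ab a'b ab' : ℕ → ℕ
      ab  m = a m * b m
      a'b m = shift a m * b m
      ab' m = a m * shift b m
      expand : ∀ m → (suc u C m) * (suc v C m) ≡ ab m + a'b m + ab' m + shift ab m
      expand zero    = cong₂ _*_ (C-suc u 0) (C-suc v 0)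
      expand (suc m) = trans (cong₂ _*_ (C-suc u (suc m)) (C-suc v (suc m)))
                             (distrib (a (suc m)) (a m) (b (suc m)) (b m))
        where distrib : ∀ x x' y y' → (x + x') * (y + y') ≡ x * y + x' * y + x * y' + x' * y'
              distrib = solve-∀

  open Recurrence using (g-sucˡ; g-sucʳ; g-suc-suc; g≗G)

  g-recurrence : ∀ u v → g (suc u) (suc v) ⊕ 1+X (g u v) ≗ 1+X (g (suc u) v ⊕ g u (suc v))
  g-recurrence u v = begin
    g (suc u) (suc v) ⊕ 1+X (g u v)             ≈⟨ ⊕-cong (g-suc-suc u v) (1+X-cong (g≗G u v)) ⟩
    1+X H ⊕ 1+X P ⊕ 1+X Q ⊕ X H ⊕ H             ≈⟨ rearrange ⟩
    1+X (H ⊕ P ⊕ (H ⊕ Q))                       ≈⟨ 1+X-cong (⊕-cong (g-sucˡ u v) (g-sucʳ u v)) ⟨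
    1+X (g (suc u) v ⊕ g u (suc v))             ∎
    where
    open ≗-Reasoning
    open Recurrence u v using (G; P; Q)
    H = 1+X G
    -- both sides are (1+x)(2H + P + Q)
    rearrange : 1+X H ⊕ 1+X P ⊕ 1+X Q ⊕ X H ⊕ H ≗ 1+X (H ⊕ P ⊕ (H ⊕ Q))
    rearrange zero    = lemma (H 0) (P 0) (Q 0)
      where lemma : ∀ h p q → h + 0 + (p + 0) + (q + 0) + 0 + h ≡ h + p + (h + q) + 0
            lemma = solve-∀
    rearrange (suc k) = lemma (H (suc k)) (H k) (P (suc k)) (P k) (Q (suc k)) (Q k)
      where lemma : ∀ h h' p p' q q' → h + h' + (p + p') + (q + q') + h' + h ≡ h + p + (h + q) + (h' + p' + (h' + q'))
            lemma = solve-∀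

  g-zeroˡ : ∀ v → g 0 v ≗ [1+X]^ v
  g-zeroˡ v k = trans (+-identityʳ _) (+-identityʳ _)

  g-zeroʳ : ∀ u → g u 0 ≗ [1+X]^ u
  g-zeroʳ u k = begin
    g u 0 k           ≡⟨ cong₂ _+_ (+-identityʳ _) (∑<-zero u (λ i _ → vanish i)) ⟩
    ((u + 0) C k) + 0 ≡⟨ cong (λ x → (x C k) + 0) (+-identityʳ u) ⟩
    (u C k) + 0       ≡⟨ +-identityʳ _ ⟩
    u C k             ∎
    where
    open ≡-Reasoning
    vanish : ∀ i → (u C suc i) * (0 C suc i) * X^ (suc i) ([1+X]^ (u + 0 ∸ suc i)) k ≡ 0
    vanish i = trans (cong (λ x → (u C suc i) * x * W) (k>n⇒nCk≡0 {0} {suc i} z<s)) (cong (_* W) (*-zeroʳ (u C suc i)))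
      where W = X^ (suc i) ([1+X]^ (u + 0 ∸ suc i)) k

  -- the edge generating function of non-crossing sets between p upper and w lower points (count≗t)
  t : ℕ → ℕ → Series
  t zero    w       = one
  t (suc p) zero    = one
  t (suc p) (suc w) = 1+X (g p w)

  t-1ˡ : ∀ w → t 1 w ≗ [1+X]^ w
  t-1ˡ zero    = ≗-sym [1+X]^-zero
  t-1ˡ (suc w) = ≗-trans (1+X-cong (g-zeroˡ w)) (≗-sym ([1+X]^-suc w))

  t-1ʳ : ∀ p → t p 1 ≗ [1+X]^ p
  t-1ʳ zero    = ≗-sym [1+X]^-zero
  t-1ʳ (suc p) = ≗-trans (1+X-cong (g-zeroʳ p)) (≗-sym ([1+X]^-suc p))

  t-recurrence : ∀ p w → t (suc p) (suc w) ⊕ 1+X (t p w) ≗ 1+X (t (suc p) w ⊕ t p (suc w))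
  t-recurrence zero w = begin
    1+X (g 0 w) ⊕ 1+X one     ≈⟨ 1+X-⊕ (g 0 w) one ⟨
    1+X (g 0 w ⊕ one)         ≈⟨ 1+X-cong (⊕-congʳ one (≗-trans (g-zeroˡ w) (≗-sym (t-1ˡ w)))) ⟩
    1+X (t 1 w ⊕ one)         ∎
    where open ≗-Reasoning
  t-recurrence (suc p) zero = begin
    1+X (g (suc p) 0) ⊕ 1+X one    ≈⟨ 1+X-⊕ (g (suc p) 0) one ⟨
    1+X (g (suc p) 0 ⊕ one)        ≈⟨ 1+X-cong (⊕-comm _ one) ⟩
    1+X (one ⊕ g (suc p) 0)        ≈⟨ 1+X-cong (⊕-congˡ one (≗-trans (g-zeroʳ (suc p)) (≗-sym (t-1ʳ (suc p))))) ⟩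
    1+X (one ⊕ t (suc p) 1)        ∎
    where open ≗-Reasoning
  t-recurrence (suc p) (suc w) = begin
    1+X (g (suc p) (suc w)) ⊕ 1+X (1+X (g p w))     ≈⟨ 1+X-⊕ (g (suc p) (suc w)) (1+X (g p w)) ⟨
    1+X (g (suc p) (suc w) ⊕ 1+X (g p w))           ≈⟨ 1+X-cong (g-recurrence p w) ⟩
    1+X (1+X (g (suc p) w ⊕ g p (suc w)))           ≈⟨ 1+X-cong (1+X-⊕ (g (suc p) w) (g p (suc w))) ⟩
    1+X (1+X (g (suc p) w) ⊕ 1+X (g p (suc w)))     ∎
    where open ≗-Reasoning

  t-additive : ∀ p w → t (suc p) (suc w) ⊕ t p w ≗ t (suc p) w ⊕ t p (suc w) ⊕ X (g p w)
  t-additive p w k = trans (xy∙z≈xz∙y (g p w k) _ (t p w k)) (cong (_+ X (g p w) k) (cancelled k))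
    where
    cancelled : g p w ⊕ t p w ≗ t (suc p) w ⊕ t p (suc w)
    cancelled = 1+X-injective (≗-trans (1+X-⊕ (g p w) (t p w)) (t-recurrence p w))

  ∑g : ℕ → ℕ → Series
  ∑g p w = ∑ˢ p (λ u → ∑ˢ w (g u))

  ∑g-additive : ∀ p w → ∑g (suc p) (suc w) ⊕ ∑g p w ≗ ∑g (suc p) w ⊕ ∑g p (suc w) ⊕ g p w
  ∑g-additive p w k = begin
    ∑g (suc p) (suc w) k + ∑g p w k
      ≡⟨ cong (_+ ∑g p w k) (trans (∑<-suc p _) (cong (∑g p (suc w) k +_) (∑<-suc w _))) ⟩
    ∑g p (suc w) k + (row + g p w k) + ∑g p w k
      ≡⟨ lemma (∑g p (suc w) k) row (g p w k) (∑g p w k) ⟩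
    (∑g p w k + row) + ∑g p (suc w) k + g p w k
      ≡⟨ cong (λ x → x + ∑g p (suc w) k + g p w k) (∑<-suc p _) ⟨
    ∑g (suc p) w k + ∑g p (suc w) k + g p w k  ∎
    where
    open ≡-Reasoning
    row = ∑ˢ w (g p) k
    lemma : ∀ s r x s' → s + (r + x) + s' ≡ s' + r + s + x
    lemma = solve-∀

  one⊕X∑g≗t : ∀ p w → one ⊕ X (∑g p w) ≗ t p w
  one⊕X∑g≗t zero    w       zero    = refl
  one⊕X∑g≗t zero    w       (suc k) = refl
  one⊕X∑g≗t (suc p) zero    zero    = refl
  one⊕X∑g≗t (suc p) zero    (suc k) = ∑<-zero (suc p) (λ _ _ → refl)
  one⊕X∑g≗t (suc p) (suc w) = ⊕-cancelʳ (t p w) (begin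
    F (suc p) (suc w) ⊕ t p w                ≈⟨ ⊕-congˡ (F (suc p) (suc w)) (one⊕X∑g≗t p w) ⟨
    F (suc p) (suc w) ⊕ F p w                ≈⟨ F-additive ⟩
    F (suc p) w ⊕ F p (suc w) ⊕ X (g p w)    ≈⟨ ⊕-congʳ _ (⊕-cong (one⊕X∑g≗t (suc p) w) (one⊕X∑g≗t p (suc w))) ⟩
    t (suc p) w ⊕ t p (suc w) ⊕ X (g p w)    ≈⟨ t-additive p w ⟨
    t (suc p) (suc w) ⊕ t p w                ∎)
    where
    open ≗-Reasoning
    F : ℕ → ℕ → Series
    F p w = one ⊕ X (∑g p w)
    F-additive : F (suc p) (suc w) ⊕ F p w ≗ F (suc p) w ⊕ F p (suc w) ⊕ X (g p w)
    F-additive zero    = refl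
    F-additive (suc k) = ∑g-additive p w k


module Formula where

  open import Data.Nat
  open import Data.Nat.Properties
  open import Data.Nat.Combinatorics using (_C_; k>n⇒nCk≡0)
  open import Data.Nat.Tactic.RingSolver using (solve-∀)
  open import Data.Sum using (inj₁; inj₂)
  open import Relation.Binary.PropositionalEquality
  open FiniteSums
  open PowerSeries
  open GeneratingFunctions

  gTerm : ℕ → ℕ → ℕ → ℕ → ℕ
  gTerm k u v m = (u C m) * (v C m) * X^ m ([1+X]^ (u + v ∸ m)) k

  fTerm : ℕ → ℕ → ℕ → ℕ → ℕ → ℕ
  fTerm n k ℓ i j = ((n ∸ i) C (ℓ ∸ 1)) * ((n ∸ j) C (ℓ ∸ 1)) * (((2 * n + 1) ∸ (ℓ + i + j)) C (k ∸ ℓ))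

  fTerm-exponent : ∀ n m i j → i < n → j < n →
             (2 * n + 1) ∸ (suc m + suc i + suc j) ≡ (n ∸ suc i) + (n ∸ suc j) ∸ m
  fTerm-exponent n m i j i<n j<n = begin
    (2 * n + 1) ∸ (suc m + suc i + suc j)  ≡⟨ cong₂ _∸_ total used ⟩
    (K + (A + B)) ∸ (K + m)                ≡⟨ [m+n]∸[m+o]≡n∸o K (A + B) m ⟩
    (A + B) ∸ m                            ∎
    where
    open ≡-Reasoning
    A = n ∸ suc i
    B = n ∸ suc j
    K = i + j + 3
    total : 2 * n + 1 ≡ K + (A + B)
    total = begin
      2 * n + 1                      ≡⟨ double n ⟩
      n + n + 1                      ≡⟨ cong₂ (λ x y → x + y + 1) (m∸n+n≡m i<n) (m∸n+n≡m j<n) ⟨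
      (A + suc i) + (B + suc j) + 1  ≡⟨ lemma A B i j ⟩
      K + (A + B)                    ∎
      where double : ∀ n → 2 * n + 1 ≡ n + n + 1
            double = solve-∀
            lemma : ∀ A B i j → (A + suc i) + (B + suc j) + 1 ≡ i + j + 3 + (A + B)
            lemma = solve-∀
    used : suc m + suc i + suc j ≡ K + m
    used = lemma m i j
      where lemma : ∀ m i j → suc m + suc i + suc j ≡ i + j + 3 + m
            lemma = solve-∀

  module _ (n k' m : ℕ) (m≤k' : m ≤ k') where
    private
      H : ℕ → ℕ → ℕ
      H i j = fTerm n (suc k') (suc m) (suc i) (suc j)

      third : ℕ → ℕ → ℕ
      third i j = ((2 * n + 1) ∸ (suc m + suc i + suc j)) C (k' ∸ m)

      short : ∀ i → n ∸ m ≤ i → i < n → n ∸ suc i < m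
      short i n∸m≤i i<n = subst (_≤ m) (+-∸-assoc 1 i<n) (m≤n+o⇒m∸n≤o n i
        (≤-trans (m≤n+m∸n n m) (≤-trans (+-monoʳ-≤ m n∸m≤i) (≤-reflexive (+-comm m i)))))

      H-vanishˡ : ∀ i j → n ∸ m ≤ i → i < n → H i j ≡ 0
      H-vanishˡ i j n∸m≤i i<n = cong (λ x → x * ((n ∸ suc j) C m) * third i j) (k>n⇒nCk≡0 (short i n∸m≤i i<n))

      H-vanishʳ : ∀ i j → n ∸ m ≤ j → j < n → H i j ≡ 0
      H-vanishʳ i j n∸m≤j j<n =
        trans (cong (λ x → ((n ∸ suc i) C m) * x * third i j) (k>n⇒nCk≡0 (short j n∸m≤j j<n)))
              (cong (_* third i j) (*-zeroʳ ((n ∸ suc i) C m)))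

      H≡gTerm : ∀ i j → i < n → j < n → H i j ≡ gTerm k' (n ∸ suc i) (n ∸ suc j) m
      H≡gTerm i j i<n j<n = cong ((((n ∸ suc i) C m) * ((n ∸ suc j) C m)) *_)
        (trans (cong (_C (k' ∸ m)) (fTerm-exponent n m i j i<n j<n)) (sym (X^-≤ m ([1+X]^ _) k' m≤k')))

    -- ℓ = m + 1, i = n - u, j = n - v
    fTerm-slice : ∑[1… (n + 1) ∸ suc m ] (λ i → ∑[1… (n + 1) ∸ suc m ] (λ j → fTerm n (suc k') (suc m) i j))
                ≡ ∑< n (λ u → ∑< n (λ v → gTerm k' u v m))
    fTerm-slice = begin
      ∑[1… (n + 1) ∸ suc m ] (λ i → ∑[1… (n + 1) ∸ suc m ] (λ j → fTerm n (suc k') (suc m) i j))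
        ≡⟨ ∑[1…]≡∑< (n + 1 ∸ suc m) _ ⟩
      ∑< (n + 1 ∸ suc m) (λ i → ∑[1… n + 1 ∸ suc m ] (λ j → fTerm n (suc k') (suc m) (suc i) j))
        ≡⟨ ∑<-cong (n + 1 ∸ suc m) (λ i _ → ∑[1…]≡∑< (n + 1 ∸ suc m) _) ⟩
      ∑< (n + 1 ∸ suc m) (λ i → ∑< (n + 1 ∸ suc m) (λ j → H i j))
        ≡⟨ cong (λ B → ∑< B (λ i → ∑< B (λ j → H i j))) (cong (_∸ suc m) (+-comm n 1)) ⟩
      ∑< (n ∸ m) (λ i → ∑< (n ∸ m) (λ j → H i j))
        ≡⟨ ∑<-cong (n ∸ m) (λ i _ → ∑<-extend (H i) (m∸n≤m n m) (λ j → H-vanishʳ i j)) ⟨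
      ∑< (n ∸ m) (λ i → ∑< n (λ j → H i j))
        ≡⟨ ∑<-extend _ (m∸n≤m n m) (λ i n∸m≤i i<n → ∑<-zero n (λ j _ → H-vanishˡ i j n∸m≤i i<n)) ⟨
      ∑< n (λ i → ∑< n (λ j → H i j))
        ≡⟨ ∑<-cong n (λ i i<n → ∑<-cong n (λ j j<n → H≡gTerm i j i<n j<n)) ⟩
      ∑< n (λ i → ∑< n (λ j → gTerm k' (n ∸ suc i) (n ∸ suc j) m))
        ≡⟨ ∑<-cong n (λ i _ → ∑<-reverse n (λ v → gTerm k' (n ∸ suc i) v m)) ⟩
      ∑< n (λ i → ∑< n (λ v → gTerm k' (n ∸ suc i) v m))
        ≡⟨ ∑<-reverse n (λ u → ∑< n (λ v → gTerm k' u v m)) ⟩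
      ∑< n (λ u → ∑< n (λ v → gTerm k' u v m)) ∎
      where open ≡-Reasoning

  formula≡∑g : ∀ n k' → formula n (suc k') ≡ ∑g n n k'
  formula≡∑g n k' = begin
    formula n (suc k')
      ≡⟨ ∑[1…]≡∑< (suc k' ⊓ n) _ ⟩
    ∑< (suc k' ⊓ n) (λ m → ∑[1… (n + 1) ∸ suc m ] (λ i → ∑[1… (n + 1) ∸ suc m ] (λ j → fTerm n (suc k') (suc m) i j)))
      ≡⟨ ∑<-cong (suc k' ⊓ n) (λ m m<k'⊓n → fTerm-slice n k' m (s≤s⁻¹ (≤-trans m<k'⊓n (m⊓n≤m (suc k') n)))) ⟩
    ∑< (suc k' ⊓ n) slice
      ≡⟨ all-slices ⟩
    ∑< n slice
      ≡⟨ ∑<-comm n n (λ m u → ∑< n (λ v → gTerm k' u v m)) ⟩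
    ∑< n (λ u → ∑< n (λ m → ∑< n (λ v → gTerm k' u v m)))
      ≡⟨ ∑<-cong n (λ u _ → ∑<-comm n n (λ m v → gTerm k' u v m)) ⟩
    ∑< n (λ u → ∑< n (λ v → ∑< n (gTerm k' u v)))
      ≡⟨ ∑<-cong n (λ u u<n → ∑<-cong n (λ v _ → ∑<-extend (gTerm k' u v) u<n
           (λ m u<m _ → cong (λ x → x * (v C m) * X^ m ([1+X]^ (u + v ∸ m)) k') (k>n⇒nCk≡0 u<m)))) ⟩
    ∑g n n k' ∎
    where
    open ≡-Reasoning
    slice : ℕ → ℕ
    slice m = ∑< n (λ u → ∑< n (λ v → gTerm k' u v m))
    slice-vanish : ∀ m → suc k' ≤ m → slice m ≡ 0
    slice-vanish m k'<m = ∑<-zero n (λ u _ → ∑<-zero n (λ v _ →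
      trans (cong ((u C m) * (v C m) *_) (X^-> m _ k' k'<m)) (*-zeroʳ ((u C m) * (v C m)))))
    all-slices : ∑< (suc k' ⊓ n) slice ≡ ∑< n slice
    all-slices with ≤-total (suc k') n
    ... | inj₁ k'<n = trans (cong (λ B → ∑< B slice) (m≤n⇒m⊓n≡m k'<n))
                            (sym (∑<-extend slice k'<n (λ m k'<m _ → slice-vanish m k'<m)))
    ... | inj₂ n≤k' = cong (λ B → ∑< B slice) (m≥n⇒m⊓n≡n n≤k')


module Forests where

  open import Data.Nat as ℕ using (ℕ; zero; suc; z≤n; s≤s)
  import Data.Nat.Properties as ℕ
  open import Data.Fin as Fin using (Fin; zero; suc; toℕ; inject₁; fromℕ; lower₁)
  open import Data.Fin.Properties
    using (toℕ-injective; toℕ-inject₁; toℕ-fromℕ; toℕ-lower₁; inject₁-lower₁; <-cmp; _≟_; ≤∧≢⇒<)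
  open import Data.List using (allFin)
  open import Data.List.Extrema.Nat using (argmax; f[xs]≤f[argmax])
  open import Data.List.Membership.Propositional.Properties using (∈-allFin)
  import Data.List.Relation.Unary.All as All
  open import Data.Product using (Σ-syntax; _×_; _,_; proj₁; proj₂)
  open import Data.Sum using (_⊎_; inj₁; inj₂)
  open import Data.Empty using (⊥)
  open import Function using (_∘_)
  open import Relation.Binary using (tri<; tri≈; tri>)
  open import Relation.Binary.PropositionalEquality
  open import Relation.Nullary using (yes; no)

  Adj-sym : ∀ {n} {E : EdgeSet n} x y → Adj E x y → Adj E y x
  Adj-sym (inj₁ a) (inj₂ b) e = e
  Adj-sym (inj₂ b) (inj₁ a) e = e

  module _ {n} {E : EdgeSet n} (cyc : Cycle E) where
    open Cycle cyc

    private
      m≢0 : m ≢ 0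
      m≢0 refl with () ← long

      m≢1 : m ≢ 1
      m≢1 refl with s≤s () ← long

    successor : ∀ i → Σ[ j ∈ Fin (suc m) ] Adj E (c i) (c j) ×
                      (toℕ j ≡ suc (toℕ i) ⊎ (j ≡ zero × toℕ i ≡ m))
    successor i with m ℕ.≟ toℕ i
    ... | yes m≡i = zero , subst (λ k → Adj E (c k) (c zero)) last≡i close , inj₂ (refl , sym m≡i)
      where last≡i : fromℕ m ≡ i
            last≡i = toℕ-injective (trans (toℕ-fromℕ m) m≡i)
    ... | no m≢i = suc (lower₁ i m≢i)
                 , subst (λ k → Adj E (c k) (c (suc (lower₁ i m≢i)))) (inject₁-lower₁ i m≢i) (step (lower₁ i m≢i))
                 , inj₁ (cong suc (toℕ-lower₁ i m≢i))

    predecessor : Fin (suc m) → Fin (suc m)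
    predecessor zero    = fromℕ m
    predecessor (suc i) = inject₁ i

    predecessor-adj : ∀ i → Adj E (c i) (c (predecessor i))
    predecessor-adj zero    = Adj-sym _ _ close
    predecessor-adj (suc i) = Adj-sym _ _ (step i)

    neighbours : ∀ i → Σ[ j ∈ Fin (suc m) ] Σ[ j' ∈ Fin (suc m) ]
                 c j ≢ c j' × Adj E (c i) (c j) × Adj E (c i) (c j')
    neighbours i with successor i
    ... | j , i~j , j-pos = j , predecessor i , (λ e → distinct i j-pos (inj e)) , i~j , predecessor-adj i
      where
      distinct : ∀ {j} i → toℕ j ≡ suc (toℕ i) ⊎ (j ≡ zero × toℕ i ≡ m) → j ≢ predecessor i
      distinct zero    (inj₁ j≡1)       refl = m≢1 (trans (sym (toℕ-fromℕ m)) j≡1)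
      distinct zero    (inj₂ (_ , 0≡m)) _    = m≢0 (sym 0≡m)
      distinct (suc i) (inj₁ j≡i+2)     refl =
        ℕ.<-irrefl (trans (sym (toℕ-inject₁ i)) j≡i+2) (ℕ.m<n+m (toℕ i) (s≤s z≤n))
      distinct (suc i) (inj₂ (refl , i+1≡m)) j≡i =
        m≢1 (trans (sym i+1≡m) (cong suc (trans (sym (toℕ-inject₁ i)) (cong toℕ (sym j≡i)))))

  upperNeighbour : ∀ {n} {E : EdgeSet n} {x} y b → x ≡ inj₂ b → Adj E x y →
                   Σ[ a ∈ Fin n ] y ≡ inj₁ a × HasEdge E a b
  upperNeighbour (inj₁ a) b refl e = a , refl , e

  lowerNeighbour : ∀ {n} {E : EdgeSet n} {x} y a → x ≡ inj₁ a → Adj E x y →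
                   Σ[ b ∈ Fin n ] y ≡ inj₂ b × HasEdge E a b
  lowerNeighbour (inj₂ b) a refl e = b , refl , e

  upperIndex : ∀ {n} → Vertex n → ℕ
  upperIndex (inj₁ a) = suc (toℕ a)
  upperIndex (inj₂ b) = 0

  module _ {n} {E : EdgeSet n} (nc : NonCrossing E) (cyc : Cycle E) where
    open Cycle cyc

    -- opaque: only the maximality of top is used, and unfolding argmax is expensive
    private opaque
      top : Fin (suc m)
      top = argmax (upperIndex ∘ c) zero (allFin (suc m))

      top-max : ∀ j → upperIndex (c j) ℕ.≤ upperIndex (c top)
      top-max j = All.lookup (f[xs]≤f[argmax] {f = upperIndex ∘ c} zero (allFin (suc m))) (∈-allFin j)

    private
      top-upper : Σ[ a ∈ Fin n ] c top ≡ inj₁ a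
      top-upper = upper (c top) refl
        where
        upper : ∀ x → c top ≡ x → Σ[ a ∈ Fin n ] c top ≡ inj₁ a
        upper (inj₁ a) top≡a = a , top≡a
        upper (inj₂ b) top≡b with neighbours cyc top
        ... | j , _ , _ , top~j , _ with upperNeighbour (c j) b top≡b top~j
        ...   | a , j≡a , _ with () ← subst₂ ℕ._≤_ (cong upperIndex j≡a) (cong upperIndex top≡b) (top-max j)

      a : Fin n
      a = proj₁ top-upper

      top≡a : c top ≡ inj₁ a
      top≡a = proj₂ top-upper

      below-a : ∀ {j a'} → c j ≡ inj₁ a' → a' Fin.≤ a
      below-a {j} j≡a' = ℕ.s≤s⁻¹ (subst₂ ℕ._≤_ (cong upperIndex j≡a') (cong upperIndex top≡a) (top-max j))

      other-upper : ∀ p b → c p ≡ inj₂ b → Σ[ a' ∈ Fin n ] a' Fin.< a × HasEdge E a' b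
      other-upper p b p≡b with neighbours cyc p
      ... | j , j' , j≢j' , p~j , p~j'
          with upperNeighbour (c j) b p≡b p~j | upperNeighbour (c j') b p≡b p~j'
      ...   | a₁ , j≡a₁ , e₁ | a₂ , j'≡a₂ , e₂ with a₁ ≟ a
      ...     | no a₁≢a  = a₁ , ≤∧≢⇒< (below-a j≡a₁) a₁≢a , e₁
      ...     | yes refl = a₂ , ≤∧≢⇒< (below-a j'≡a₂) (λ { refl → j≢j' (trans j≡a₁ (sym j'≡a₂)) }) , e₂

      crossing : ∀ {p b b'} → c p ≡ inj₂ b' → HasEdge E a b → b Fin.< b' → ⊥
      crossing {p} {b} {b'} p≡b' e b<b' with other-upper p b' p≡b'
      ... | a' , a'<a , e' = nc a' b' a b e' e a'<a b<b'

    nonCrossing-acyclic : ⊥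
    nonCrossing-acyclic with neighbours cyc top
    ... | j₁ , j₂ , j₁≢j₂ , top~j₁ , top~j₂
        with lowerNeighbour (c j₁) a top≡a top~j₁ | lowerNeighbour (c j₂) a top≡a top~j₂
    ...   | b₁ , j₁≡b₁ , e₁ | b₂ , j₂≡b₂ , e₂ with <-cmp b₁ b₂
    ...     | tri< b₁<b₂ _ _ = crossing j₂≡b₂ e₁ b₁<b₂
    ...     | tri≈ _ refl _  = j₁≢j₂ (trans j₁≡b₁ (sym j₂≡b₂))
    ...     | tri> _ _ b₂<b₁ = crossing j₁≡b₁ e₂ b₂<b₁

  nonCrossing⇒forest : ∀ {n} {E : EdgeSet n} → NonCrossing E → IsForest E
  nonCrossing⇒forest = nonCrossing-acyclic

module ListSums where

  open import Data.Nat using (ℕ; zero; suc; _+_)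
  open import Data.Nat.Properties using (+-assoc)
  open import Data.Bool using (Bool; true; false; if_then_else_)
  open import Data.List using (List; []; _∷_; _++_; map; cartesianProductWith; length; filterᵇ)
  open import Relation.Binary.PropositionalEquality
  open PowerSeries using (Series; X)

  ∑ₗ : ∀ {A : Set} → List A → (A → ℕ) → ℕ
  ∑ₗ []       f = 0
  ∑ₗ (x ∷ xs) f = f x + ∑ₗ xs f

  ∑ₗ-cong : ∀ {A : Set} (xs : List A) {f g : A → ℕ} → (∀ x → f x ≡ g x) → ∑ₗ xs f ≡ ∑ₗ xs g
  ∑ₗ-cong []       f≡g = refl
  ∑ₗ-cong (x ∷ xs) f≡g = cong₂ _+_ (f≡g x) (∑ₗ-cong xs f≡g)

  ∑ₗ-zero : ∀ {A : Set} (xs : List A) {f : A → ℕ} → (∀ x → f x ≡ 0) → ∑ₗ xs f ≡ 0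
  ∑ₗ-zero []       f≡0 = refl
  ∑ₗ-zero (x ∷ xs) f≡0 = cong₂ _+_ (f≡0 x) (∑ₗ-zero xs f≡0)

  ∑ₗ-++ : ∀ {A : Set} (xs ys : List A) f → ∑ₗ (xs ++ ys) f ≡ ∑ₗ xs f + ∑ₗ ys f
  ∑ₗ-++ []       ys f = refl
  ∑ₗ-++ (x ∷ xs) ys f = trans (cong (f x +_) (∑ₗ-++ xs ys f)) (sym (+-assoc (f x) _ _))

  ∑ₗ-map : ∀ {A B : Set} (g : A → B) (xs : List A) f → ∑ₗ (map g xs) f ≡ ∑ₗ xs (λ x → f (g x))
  ∑ₗ-map g []       f = refl
  ∑ₗ-map g (x ∷ xs) f = cong (f (g x) +_) (∑ₗ-map g xs f)

  ∑ₗ-cartesianProductWith : ∀ {A B C : Set} (g : A → B → C) (xs : List A) (ys : List B) f →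
    ∑ₗ (cartesianProductWith g xs ys) f ≡ ∑ₗ xs (λ x → ∑ₗ ys (λ y → f (g x y)))
  ∑ₗ-cartesianProductWith g []       ys f = refl
  ∑ₗ-cartesianProductWith g (x ∷ xs) ys f = begin
    ∑ₗ (map (g x) ys ++ cartesianProductWith g xs ys) f
      ≡⟨ ∑ₗ-++ (map (g x) ys) _ f ⟩
    ∑ₗ (map (g x) ys) f + ∑ₗ (cartesianProductWith g xs ys) f
      ≡⟨ cong₂ _+_ (∑ₗ-map (g x) ys f) (∑ₗ-cartesianProductWith g xs ys f) ⟩
    ∑ₗ ys (λ y → f (g x y)) + ∑ₗ xs (λ x → ∑ₗ ys (λ y → f (g x y))) ∎
    where open ≡-Reasoning

  indicator : Bool → ℕ
  indicator b = if b then 1 else 0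

  length-filterᵇ : ∀ {A : Set} (p : A → Bool) xs → length (filterᵇ p xs) ≡ ∑ₗ xs (λ x → indicator (p x))
  length-filterᵇ p []       = refl
  length-filterᵇ p (x ∷ xs) with p x
  ... | true  = cong suc (length-filterᵇ p xs)
  ... | false = length-filterᵇ p xs

  ∑ₗˢ : ∀ {A : Set} → List A → (A → Series) → Series
  ∑ₗˢ xs h k = ∑ₗ xs (λ x → h x k)

  X-∑ₗˢ : ∀ {A : Set} (xs : List A) h → X (∑ₗˢ xs h) ≗ ∑ₗˢ xs (λ x → X (h x))
  X-∑ₗˢ xs h zero    = sym (∑ₗ-zero xs (λ _ → refl))
  X-∑ₗˢ xs h (suc k) = refl


module Enumeration where

  open import Data.Nat using (ℕ; zero; suc)
  open import Data.Bool using (Bool; true; false; T)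
  open import Data.Bool.Properties using (T?)
  open import Data.Vec using (Vec; []; _∷_)
  open import Data.Vec.Properties using (∷-injective)
  open import Data.List using (List; []; _∷_; cartesianProductWith; length; filterᵇ)
  open import Data.List.Membership.Propositional using (_∈_)
  open import Data.List.Membership.Propositional.Properties using (∈-cartesianProductWith⁺; ∈-filter⁺; ∈-filter⁻)
  open import Data.List.Relation.Unary.Any using (here; there)
  import Data.List.Relation.Unary.All as All
  open import Data.List.Relation.Unary.AllPairs using ([]; _∷_)
  open import Data.List.Relation.Unary.Unique.Propositional using (Unique)
  import Data.List.Relation.Unary.Unique.Propositional.Properties as Unique
  open import Data.Product using (Σ; _×_; _,_; proj₂)
  open import Function using (_∘_)
  open import Function.Bundles using (_⇔_; Equivalence)
  open import Relation.Binary.PropositionalEquality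
  open ListSums using (∑ₗ; indicator; length-filterᵇ)

  vectors : ∀ {A : Set} → List A → (p : ℕ) → List (Vec A p)
  vectors xs zero    = [] ∷ []
  vectors xs (suc p) = cartesianProductWith _∷_ xs (vectors xs p)

  vectors-unique : ∀ {A : Set} {xs : List A} p → Unique xs → Unique (vectors xs p)
  vectors-unique zero    _  = All.[] ∷ []
  vectors-unique (suc p) xs! = Unique.cartesianProductWith⁺ _∷_ ∷-injective xs! (vectors-unique p xs!)

  ∈-vectors : ∀ {A : Set} {xs : List A} p → (∀ x → x ∈ xs) → ∀ v → v ∈ vectors xs p
  ∈-vectors zero    _    []      = here refl
  ∈-vectors (suc p) ∈xs (x ∷ v) = ∈-cartesianProductWith⁺ _∷_ (∈xs x) (∈-vectors p ∈xs v)

  bools : List Bool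
  bools = true ∷ false ∷ []

  ∈-bools : ∀ b → b ∈ bools
  ∈-bools true  = here refl
  ∈-bools false = there (here refl)

  rows : (q : ℕ) → List (Vec Bool q)
  rows = vectors bools

  matrices : (p q : ℕ) → List (Vec (Vec Bool q) p)
  matrices p q = vectors (rows q) p

  matrices-unique : ∀ p q → Unique (matrices p q)
  matrices-unique p q = vectors-unique p (vectors-unique q (((λ ()) All.∷ All.[]) ∷ All.[] ∷ []))

  ∈-matrices : ∀ {p q} (M : Vec (Vec Bool q) p) → M ∈ matrices p q
  ∈-matrices {p} {q} = ∈-vectors p (∈-vectors q ∈-bools)

  filterᵇ-listing : ∀ {A : Set} {P : A → Set} {m} (xs : List A) (p : A → Bool) →
                    Unique xs → (∀ x → x ∈ xs) → (∀ x → T (p x) ⇔ P x) → ∑ₗ xs (indicator ∘ p) ≡ m →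
                    Σ (List A) λ L → Unique L × (∀ x → (x ∈ L → P x) × (P x → x ∈ L)) × length L ≡ m
  filterᵇ-listing xs p xs! ∈xs p⇔P count≡m =
    filterᵇ p xs ,
    Unique.filter⁺ (T? ∘ p) xs! ,
    (λ x → (λ x∈L → Equivalence.to (p⇔P x) (proj₂ (∈-filter⁻ (T? ∘ p) {xs = xs} x∈L))) ,
           (λ Px → ∈-filter⁺ (T? ∘ p) (∈xs x) (Equivalence.from (p⇔P x) Px))) ,
    trans (length-filterᵇ p xs) count≡m


module Rows where

  open import Data.Nat as ℕ using (ℕ; zero; suc; _⊔_; z≤n; s≤s)
  import Data.Nat.Properties as ℕ
  open import Data.Bool using (Bool; true; false; T; not; _∧_; _∨_; if_then_else_)
  open import Data.Bool.Properties using (∨-zeroʳ; T-∧)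
  open import Data.Fin using (Fin; zero; suc; toℕ; _<_)
  open import Data.Vec using (Vec; []; _∷_; lookup)
  open import Data.Product using (Σ-syntax; _×_; _,_; proj₁; proj₂)
  open import Data.Empty using (⊥)
  open import Function.Bundles using (Equivalence)
  open import Relation.Binary.PropositionalEquality
  open import Relation.Nullary using (yes; no; contradiction)

  anyTrue : ∀ {q} → Vec Bool q → Bool
  anyTrue []      = false
  anyTrue (b ∷ r) = b ∨ anyTrue r

  -- index of the last true entry, 0 if there is none
  lastTrue : ∀ {q} → Vec Bool q → ℕ
  lastTrue []      = 0
  lastTrue (_ ∷ r) = if anyTrue r then suc (lastTrue r) else 0

  clearBelow : ∀ {q} → ℕ → Vec Bool q → Bool
  clearBelow zero    r       = true
  clearBelow (suc c) []      = true
  clearBelow (suc c) (b ∷ r) = not b ∧ clearBelow c r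

  -- Row a lists the lower neighbours of upper point a.  Scanning the rows in order, no edge may
  -- reach a lower point left of c, the rightmost lower point used so far.
  nonCrossingFrom : ∀ {p q} → ℕ → Vec (Vec Bool q) p → Bool
  nonCrossingFrom c []      = true
  nonCrossingFrom c (r ∷ M) = clearBelow c r ∧ nonCrossingFrom (c ⊔ lastTrue r) M

  anyTrue-lookup : ∀ {q} (r : Vec Bool q) b → lookup r b ≡ true → anyTrue r ≡ true
  anyTrue-lookup (true ∷ r) zero    _ = refl
  anyTrue-lookup (x ∷ r)    (suc b) e = trans (cong (x ∨_) (anyTrue-lookup r b e)) (∨-zeroʳ x)

  lastTrue-≥ : ∀ {q} (r : Vec Bool q) b → lookup r b ≡ true → toℕ b ℕ.≤ lastTrue r
  lastTrue-≥ (x ∷ r) zero    e = z≤n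
  lastTrue-≥ (x ∷ r) (suc b) e with anyTrue r in any
  ... | true  = s≤s (lastTrue-≥ r b e)
  ... | false with () ← trans (sym (anyTrue-lookup r b e)) any

  lastTrue-attained : ∀ {q} (r : Vec Bool q) → anyTrue r ≡ true →
                      Σ[ b ∈ Fin q ] lookup r b ≡ true × toℕ b ≡ lastTrue r
  lastTrue-attained (x ∷ r) _ with anyTrue r in any
  ... | true with lastTrue-attained r any
  ...   | b , e , b≡last = suc b , e , cong suc b≡last
  lastTrue-attained (true ∷ r) _ | false = zero , refl , refl

  lastTrue-none : ∀ {q} (r : Vec Bool q) → anyTrue r ≡ false → lastTrue r ≡ 0
  lastTrue-none []      _ = refl
  lastTrue-none (x ∷ r) _ with anyTrue r
  ... | false = refl
  lastTrue-none (false ∷ r) () | true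
  lastTrue-none (true ∷ r)  () | true

  suc⊔lastTrue : ∀ {q} c b (r : Vec Bool q) → suc c ⊔ lastTrue (b ∷ r) ≡ suc (c ⊔ lastTrue r)
  suc⊔lastTrue c b r with anyTrue r in any
  ... | true  = refl
  ... | false = cong suc (sym (trans (cong (c ⊔_) (lastTrue-none r any)) (ℕ.⊔-identityʳ c)))

  clearBelow-sound : ∀ {q} c (r : Vec Bool q) → T (clearBelow c r) → ∀ b → lookup r b ≡ true → c ℕ.≤ toℕ b
  clearBelow-sound zero    r          _  b       _ = z≤n
  clearBelow-sound (suc c) (false ∷ r) ok (suc b) e = s≤s (clearBelow-sound c r ok b e)
  clearBelow-sound (suc c) (true ∷ r)  () b       e
  clearBelow-sound (suc c) (false ∷ r) ok zero    ()

  clearBelow-complete : ∀ {q} c (r : Vec Bool q) → (∀ b → lookup r b ≡ true → c ℕ.≤ toℕ b) → T (clearBelow c r)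
  clearBelow-complete zero    r           _     = _
  clearBelow-complete (suc c) []          _     = _
  clearBelow-complete (suc c) (true ∷ r)  right with () ← right zero refl
  clearBelow-complete (suc c) (false ∷ r) right = clearBelow-complete c r (λ b e → ℕ.s≤s⁻¹ (right (suc b) e))

  Edge : ∀ {p q} → Vec (Vec Bool q) p → Fin p → Fin q → Set
  Edge M a b = lookup (lookup M a) b ≡ true

  ColumnsFrom : ∀ {p q} → ℕ → Vec (Vec Bool q) p → Set
  ColumnsFrom c M = ∀ a b → Edge M a b → c ℕ.≤ toℕ b

  NonCrossingᴿ : ∀ {p q} → Vec (Vec Bool q) p → Set
  NonCrossingᴿ M = ∀ a b a' b' → Edge M a b → Edge M a' b' → a < a' → b' < b → ⊥

  nonCrossingFrom-sound : ∀ {p q} c (M : Vec (Vec Bool q) p) → T (nonCrossingFrom c M) →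
                          ColumnsFrom c M × NonCrossingᴿ M
  nonCrossingFrom-sound c []      _  = (λ ()) , (λ ())
  nonCrossingFrom-sound c (r ∷ M) ok = columns , nonCrossing
    where
    row-ok = proj₁ (Equivalence.to T-∧ ok)
    rest   = nonCrossingFrom-sound (c ⊔ lastTrue r) M (proj₂ (Equivalence.to T-∧ ok))

    columns : ColumnsFrom c (r ∷ M)
    columns zero    b e = clearBelow-sound c r row-ok b e
    columns (suc a) b e = ℕ.≤-trans (ℕ.m≤m⊔n c (lastTrue r)) (proj₁ rest a b e)

    nonCrossing : NonCrossingᴿ (r ∷ M)
    nonCrossing zero    b (suc a') b' e e' _         b'<b =
      ℕ.<⇒≱ b'<b (ℕ.≤-trans (lastTrue-≥ r b e) (ℕ.≤-trans (ℕ.m≤n⊔m c (lastTrue r)) (proj₁ rest a' b' e')))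
    nonCrossing (suc a) b (suc a') b' e e' (s≤s a<a') b'<b = proj₂ rest a b a' b' e e' a<a' b'<b

  nonCrossingFrom-complete : ∀ {p q} c (M : Vec (Vec Bool q) p) → ColumnsFrom c M → NonCrossingᴿ M →
                             T (nonCrossingFrom c M)
  nonCrossingFrom-complete c []      _       _  = _
  nonCrossingFrom-complete c (r ∷ M) columns nc =
    Equivalence.from T-∧ (clearBelow-complete c r (columns zero) ,
                          nonCrossingFrom-complete (c ⊔ lastTrue r) M columns' nc')
    where
    lastTrue-≤ : ∀ a' b' → Edge M a' b' → lastTrue r ℕ.≤ toℕ b'
    lastTrue-≤ a' b' e' with anyTrue r in any
    ... | false = subst (ℕ._≤ toℕ b') (sym (lastTrue-none r any)) z≤n
    ... | true with lastTrue-attained r any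
    ...   | b , e , b≡last with toℕ b' ℕ.<? toℕ b
    ...     | yes b'<b = contradiction b'<b (nc zero b (suc a') b' e e' ℕ.z<s)
    ...     | no  b'≮b = subst (ℕ._≤ toℕ b') b≡last (ℕ.≮⇒≥ b'≮b)

    columns' : ColumnsFrom (c ⊔ lastTrue r) M
    columns' a' b' e' = ℕ.⊔-lub (columns (suc a') b' e') (lastTrue-≤ a' b' e')

    nc' : NonCrossingᴿ M
    nc' a b a' b' e e' a<a' b'<b = nc (suc a) b (suc a') b' e e' (s≤s a<a') b'<b


module Counting where

  open import Data.Nat as ℕ using (ℕ; zero; suc; _+_; _∸_; _⊔_; _≡ᵇ_; s≤s)
  import Data.Nat.Properties as ℕ
  open import Data.Bool using (Bool; true; false; _∧_; if_then_else_)
  open import Data.Bool.Properties using (∧-zeroʳ)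
  open import Data.Vec using (Vec; []; _∷_)
  import Data.Vec as V
  open import Data.List using (List)
  open import Function using (_∘_)
  open import Relation.Binary.PropositionalEquality
  open PowerSeries
  open GeneratingFunctions using (t; t-recurrence)
  open Enumeration
  open ListSums
  open Rows

  edgeCount : ∀ {p q} → Vec (Vec Bool q) p → ℕ
  edgeCount M = V.sum (V.map countTrue M)

  admissible : ∀ {p q} → ℕ → ℕ → Vec (Vec Bool q) p → Bool
  admissible c k M = (edgeCount M ≡ᵇ k) ∧ nonCrossingFrom c M

  count : ℕ → ℕ → ℕ → Series
  count q p c k = ∑ₗ (matrices p q) (λ M → indicator (admissible c k M))

  rowTerm : ∀ {q} → ℕ → (ℕ → Series) → Vec Bool q → Series
  rowTerm c f r = if clearBelow c r then X^ (countTrue r) (f (c ⊔ lastTrue r)) else (λ _ → 0)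

  rowTransfer : ℕ → ℕ → (ℕ → Series) → Series
  rowTransfer q c f = ∑ₗˢ (rows q) (rowTerm c f)

  ∑ₗ-indicator-shift : ∀ {A : Set} (xs : List A) (e : A → ℕ) (P : A → Bool) a k →
    ∑ₗ xs (λ x → indicator ((a + e x ≡ᵇ k) ∧ P x)) ≡ X^ a (λ k → ∑ₗ xs (λ x → indicator ((e x ≡ᵇ k) ∧ P x))) k
  ∑ₗ-indicator-shift xs e P zero    k       = refl
  ∑ₗ-indicator-shift xs e P (suc a) zero    = ∑ₗ-zero xs (λ _ → refl)
  ∑ₗ-indicator-shift xs e P (suc a) (suc k) = ∑ₗ-indicator-shift xs e P a k

  count-suc : ∀ q p c → count q (suc p) c ≗ rowTransfer q c (count q p)
  count-suc q p c k = trans (∑ₗ-cartesianProductWith _∷_ (rows q) (matrices p q) _) (∑ₗ-cong (rows q) row)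
    where
    row : ∀ r → ∑ₗ (matrices p q) (λ M → indicator (admissible c k (r ∷ M))) ≡ rowTerm c (count q p) r k
    row r with clearBelow c r
    ... | true  = ∑ₗ-indicator-shift (matrices p q) edgeCount (nonCrossingFrom (c ⊔ lastTrue r)) (countTrue r) k
    ... | false = ∑ₗ-zero (matrices p q) (λ M → cong indicator (∧-zeroʳ _))

  rowTransfer-suc : ∀ q c f → rowTransfer (suc q) (suc c) f ≗ rowTransfer q c (f ∘ suc)
  rowTransfer-suc q c f k = begin
    rowTransfer (suc q) (suc c) f k
      ≡⟨ ∑ₗ-cartesianProductWith _∷_ bools (rows q) _ ⟩
    ∑ₗ (rows q) (λ _ → 0) + (∑ₗ (rows q) (λ r → rowTerm (suc c) f (false ∷ r) k) + 0)
      ≡⟨ cong₂ _+_ (∑ₗ-zero (rows q) (λ _ → refl)) (ℕ.+-identityʳ _) ⟩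
    ∑ₗ (rows q) (λ r → rowTerm (suc c) f (false ∷ r) k)
      ≡⟨ ∑ₗ-cong (rows q) (λ r → cong (λ x → (if clearBelow c r then X^ (countTrue r) (f x) else λ _ → 0) k)
                                      (suc⊔lastTrue c false r)) ⟩
    rowTransfer q c (f ∘ suc) k ∎
    where open ≡-Reasoning

  rowTransfer-full : ∀ q f → rowTransfer q q f ≗ f q
  rowTransfer-full zero    f k = ℕ.+-identityʳ _
  rowTransfer-full (suc q) f   = ≗-trans (rowTransfer-suc q q f) (rowTransfer-full q (f ∘ suc))

  rowTransfer-zero : ∀ q f →
    rowTransfer (suc q) 0 f ≗ 1+X (∑ₗˢ (rows q) (λ r → X^ (countTrue r) (f (lastTrue (false ∷ r)))))
  rowTransfer-zero q f k = begin
    rowTransfer (suc q) 0 f k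
      ≡⟨ ∑ₗ-cartesianProductWith _∷_ bools (rows q) _ ⟩
    ∑ₗ (rows q) (λ r → X (h r) k) + (∑ₗ (rows q) (λ r → h r k) + 0)
      ≡⟨ cong₂ _+_ (X-∑ₗˢ (rows q) h k) (sym (ℕ.+-identityʳ _)) ⟨
    X (∑ₗˢ (rows q) h) k + ∑ₗˢ (rows q) h k
      ≡⟨ ℕ.+-comm (X (∑ₗˢ (rows q) h) k) _ ⟩
    1+X (∑ₗˢ (rows q) h) k ∎
    where
    open ≡-Reasoning
    h : Vec Bool q → Series
    h r = X^ (countTrue r) (f (lastTrue (false ∷ r)))

  zeros : ∀ q → Vec Bool q
  zeros q = V.replicate q false

  ∑ₗˢ-rows-exchange : ∀ q (h h' : Vec Bool q → Series) → (∀ r → anyTrue r ≡ true → h r ≗ h' r) →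
                      ∑ₗˢ (rows q) h ⊕ h' (zeros q) ≗ ∑ₗˢ (rows q) h' ⊕ h (zeros q)
  ∑ₗˢ-rows-exchange zero    h h' _  k =
    trans (cong (_+ h' [] k) (ℕ.+-identityʳ _)) (trans (ℕ.+-comm (h [] k) _) (cong (_+ h [] k) (sym (ℕ.+-identityʳ _))))
  ∑ₗˢ-rows-exchange (suc q) h h' eq k = begin
    ∑ₗˢ (rows (suc q)) h k + h' z k   ≡⟨ cong (_+ h' z k) (∑ₗ-cartesianProductWith _∷_ bools (rows q) _) ⟩
    (S₁ + (S₀ + 0)) + h' z k   ≡⟨ rearrange S₁ S₀ (h' z k) ⟩
    S₁ + (S₀ + h' z k)         ≡⟨ cong₂ _+_ (∑ₗ-cong (rows q) (λ r → eq (true ∷ r) refl k)) IH ⟩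
    S₁' + (S₀' + h z k)        ≡⟨ rearrange S₁' S₀' (h z k) ⟨
    (S₁' + (S₀' + 0)) + h z k  ≡⟨ cong (_+ h z k) (∑ₗ-cartesianProductWith _∷_ bools (rows q) _) ⟨
    ∑ₗˢ (rows (suc q)) h' k + h z k  ∎
    where
    open ≡-Reasoning
    z = zeros (suc q)
    S₁  = ∑ₗ (rows q) (λ r → h  (true ∷ r) k)
    S₁' = ∑ₗ (rows q) (λ r → h' (true ∷ r) k)
    S₀  = ∑ₗ (rows q) (λ r → h  (false ∷ r) k)
    S₀' = ∑ₗ (rows q) (λ r → h' (false ∷ r) k)
    IH = ∑ₗˢ-rows-exchange q (λ r → h (false ∷ r)) (λ r → h' (false ∷ r)) (λ r → eq (false ∷ r)) k
    rearrange : ∀ a b c → (a + (b + 0)) + c ≡ a + (b + c)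
    rearrange a b c = trans (cong (λ x → a + x + c) (ℕ.+-identityʳ b)) (ℕ.+-assoc a b c)

  countTrue-zeros : ∀ q → countTrue (zeros q) ≡ 0
  countTrue-zeros zero    = refl
  countTrue-zeros (suc q) = countTrue-zeros q

  anyTrue-zeros : ∀ q → anyTrue (zeros q) ≡ false
  anyTrue-zeros zero    = refl
  anyTrue-zeros (suc q) = anyTrue-zeros q

  rowTransfer-step : ∀ q c f → c ℕ.< q →
                     rowTransfer q c f ⊕ 1+X (f (suc c)) ≗ 1+X (rowTransfer q (suc c) f) ⊕ 1+X (f c)
  rowTransfer-step (suc q) zero f _ = begin
    rowTransfer (suc q) 0 f ⊕ 1+X (f 1)        ≈⟨ ⊕-congʳ (1+X (f 1)) (rowTransfer-zero q f) ⟩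
    1+X (∑ₗˢ (rows q) h) ⊕ 1+X (f 1)           ≈⟨ 1+X-⊕ (∑ₗˢ (rows q) h) (f 1) ⟨
    1+X (∑ₗˢ (rows q) h ⊕ f 1)                 ≈⟨ 1+X-cong (⊕-congˡ (∑ₗˢ (rows q) h) h'-zeros) ⟨
    1+X (∑ₗˢ (rows q) h ⊕ h' (zeros q))        ≈⟨ 1+X-cong (∑ₗˢ-rows-exchange q h h' h≗h') ⟩
    1+X (∑ₗˢ (rows q) h' ⊕ h (zeros q))        ≈⟨ 1+X-cong (⊕-congˡ (∑ₗˢ (rows q) h') h-zeros) ⟩
    1+X (∑ₗˢ (rows q) h' ⊕ f 0)                ≈⟨ 1+X-⊕ (∑ₗˢ (rows q) h') (f 0) ⟩
    1+X (∑ₗˢ (rows q) h') ⊕ 1+X (f 0)          ≈⟨ ⊕-congʳ (1+X (f 0)) (1+X-cong (rowTransfer-suc q 0 f)) ⟨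
    1+X (rowTransfer (suc q) 1 f) ⊕ 1+X (f 0)  ∎
    where
    open ≗-Reasoning
    h h' : Vec Bool q → Series
    h  r = X^ (countTrue r) (f (lastTrue (false ∷ r)))
    h' r = X^ (countTrue r) (f (suc (lastTrue r)))
    h≗h' : ∀ r → anyTrue r ≡ true → h r ≗ h' r
    h≗h' r any k = cong (λ b → X^ (countTrue r) (f (if b then suc (lastTrue r) else 0)) k) any
    h-zeros : h (zeros q) ≗ f 0
    h-zeros k = cong₂ (λ n b → X^ n (f (if b then suc (lastTrue (zeros q)) else 0)) k)
                      (countTrue-zeros q) (anyTrue-zeros q)
    h'-zeros : h' (zeros q) ≗ f 1
    h'-zeros k = cong₂ (λ n l → X^ n (f (suc l)) k) (countTrue-zeros q) (lastTrue-none (zeros q) (anyTrue-zeros q))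
  rowTransfer-step (suc q) (suc c) f (s≤s c<q) = begin
    rowTransfer (suc q) (suc c) f ⊕ 1+X (f (suc (suc c)))        ≈⟨ ⊕-congʳ _ (rowTransfer-suc q c f) ⟩
    rowTransfer q c (f ∘ suc) ⊕ 1+X (f (suc (suc c)))            ≈⟨ rowTransfer-step q c (f ∘ suc) c<q ⟩
    1+X (rowTransfer q (suc c) (f ∘ suc)) ⊕ 1+X (f (suc c))      ≈⟨ ⊕-congʳ _ (1+X-cong (rowTransfer-suc q (suc c) f)) ⟨
    1+X (rowTransfer (suc q) (suc (suc c)) f) ⊕ 1+X (f (suc c))  ∎
    where open ≗-Reasoning

  count-zero : ∀ q c → count q 0 c ≗ one
  count-zero q c zero    = refl
  count-zero q c (suc k) = refl

  count-full : ∀ q p → count q p q ≗ one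
  count-full q zero    = count-zero q q
  count-full q (suc p) = ≗-trans (count-suc q p q) (≗-trans (rowTransfer-full q (count q p)) (count-full q p))

  count≗t : ∀ q p w → w ℕ.≤ q → count q p (q ∸ w) ≗ t p w
  count≗t q zero    w       _   = count-zero q (q ∸ w)
  count≗t q (suc p) zero    _   = count-full q (suc p)
  count≗t q (suc p) (suc w) w<q = ⊕-cancelʳ (1+X (t p w)) (begin
    count q (suc p) c ⊕ 1+X (t p w)
      ≈⟨ ⊕-congˡ (count q (suc p) c) (1+X-cong (shifted p (count≗t q p w w≤q))) ⟨
    count q (suc p) c ⊕ 1+X (count q p (suc c))
      ≈⟨ ⊕-congʳ (1+X (count q p (suc c))) (count-suc q p c) ⟩
    rowTransfer q c (count q p) ⊕ 1+X (count q p (suc c))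
      ≈⟨ rowTransfer-step q c (count q p) c<q ⟩
    1+X (rowTransfer q (suc c) (count q p)) ⊕ 1+X (count q p c)
      ≈⟨ ⊕-congʳ (1+X (count q p c)) (1+X-cong (count-suc q p (suc c))) ⟨
    1+X (count q (suc p) (suc c)) ⊕ 1+X (count q p c)
      ≈⟨ ⊕-cong (1+X-cong (shifted (suc p) (count≗t q (suc p) w w≤q))) (1+X-cong (count≗t q p (suc w) w<q)) ⟩
    1+X (t (suc p) w) ⊕ 1+X (t p (suc w))
      ≈⟨ 1+X-⊕ (t (suc p) w) (t p (suc w)) ⟨
    1+X (t (suc p) w ⊕ t p (suc w))
      ≈⟨ t-recurrence p w ⟨
    t (suc p) (suc w) ⊕ 1+X (t p w) ∎)
    where
    open ≗-Reasoning
    c = q ∸ suc w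
    q∸w≡1+c : q ∸ w ≡ suc c
    q∸w≡1+c = ℕ.+-∸-assoc 1 w<q
    c<q : c ℕ.< q
    c<q = subst (ℕ._≤ q) q∸w≡1+c (ℕ.m∸n≤m q w)
    w≤q : w ℕ.≤ q
    w≤q = ℕ.<⇒≤ w<q
    shifted : ∀ p' → count q p' (q ∸ w) ≗ t p' w → count q p' (suc c) ≗ t p' w
    shifted p' eq k = trans (cong (λ c' → count q p' c' k) (sym q∸w≡1+c)) (eq k)


open import Data.Nat using (suc; z≤n; _∸_)
open import Data.Nat.Properties using (≡ᵇ⇒≡; ≡⇒≡ᵇ; n∸n≡0; ≤-refl)
open import Data.Bool using (T)
open import Data.Bool.Properties using (T-∧)
open import Data.Product using (_,_; proj₁; proj₂)
open import Function.Bundles using (_⇔_; Equivalence; mk⇔)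
open import Relation.Binary.PropositionalEquality using (cong; module ≡-Reasoning)

open GeneratingFunctions using (t; ∑g; one⊕X∑g≗t)
open Formula using (formula≡∑g)
open Forests using (nonCrossing⇒forest)
open Enumeration using (matrices; matrices-unique; ∈-matrices; filterᵇ-listing)
open Rows using (nonCrossingFrom-sound; nonCrossingFrom-complete)
open Counting using (admissible; count; count≗t)

admissible⇔InFI : ∀ n k (E : EdgeSet n) → T (admissible 0 k E) ⇔ InFI n k E
admissible⇔InFI n k E = mk⇔ to from
  where
  to : T (admissible 0 k E) → InFI n k E
  to ok = nc , nonCrossing⇒forest nc , ≡ᵇ⇒≡ (numEdges E) k (proj₁ parts)
    where
    parts = Equivalence.to T-∧ ok
    nc    = proj₂ (nonCrossingFrom-sound 0 E (proj₂ parts))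
  from : InFI n k E → T (admissible 0 k E)
  from (nc , _ , size) =
    Equivalence.from T-∧ (≡⇒≡ᵇ (numEdges E) k size , nonCrossingFrom-complete 0 E (λ _ _ _ → z≤n) nc)

count≡formula : ∀ n k' → count n n 0 (suc k') ≡ formula n (suc k')
count≡formula n k' = begin
  count n n 0 (suc k')        ≡⟨ cong (λ c → count n n c (suc k')) (n∸n≡0 n) ⟨
  count n n (n ∸ n) (suc k')  ≡⟨ count≗t n n n ≤-refl (suc k') ⟩
  t n n (suc k')              ≡⟨ one⊕X∑g≗t n n (suc k') ⟨
  ∑g n n k'                   ≡⟨ formula≡∑g n k' ⟨
  formula n (suc k')          ∎
  where open ≡-Reasoning

proposition6 : (n k : ℕ) → 1 ≤ k →
    Σ (List (EdgeSet n)) (λ L →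
      Unique L ×
      ((E : EdgeSet n) → (E ∈ L → InFI n k E) × (InFI n k E → E ∈ L)) ×
      length L ≡ formula n k)
proposition6 n (suc k') _ =
  filterᵇ-listing (matrices n n) (admissible 0 (suc k')) (matrices-unique n n) ∈-matrices
                  (admissible⇔InFI n (suc k')) (count≡formula n k')
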